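{- Let $G=(V,E)$ be an interval graph, let $Q_1,\dots,Q_r$ be a linear ordering of its maximal cliques such that for every vertex the maximal cliques containing it occur consecutively, and let $H_G$ be the canonical interval representation constructed from this ordering (as in the context). Then $G$ is isomorphic to the intersection graph of the intervals of $H_G$, via $v\mapsto J(v)$.
   Context: Let $l(v)$ (resp. $r(v)$) be the index of the first (resp. last) maximal clique containing $v$. For each $i$, let $L_i=\{v: l(v)=i\}$ listed as $v_1,\dots,v_{t}$ in decreasing order of $r(v)$, and $R_i=\{v: r(v)=i\}$ listed as $w_1,\dots,w_{s}$ in increasing order of $l(v)$ (ties broken arbitrarily). Gadget $D_i$ is a block of consecutive integer points $z_i-(t-1),\dots,z_i,\dots,z_i+(s-1)$ with distinguished point $z_i$. The gadgets $D_1,\dots,D_r$ are placed left to right on the integer line in this order, with exactly one additional integer point between each pair of consecutive gadgets. For each vertex $v$, the stretched interval $J(v)$ consists of all integer points from its left endpoint $z_{l(v)}-k+1$ (where $v$ is the $k$-th vertex in the list of $L_{l(v)}$) to its right endpoint $z_{r(v)}+k-1$ (where $v$ is the $k$-th vertex in the list of $R_{r(v)}$). $H_G$ is the interval hypergraph whose vertices are all gadget points and the $r-1$ additional points and whose hyperedges are the $J(v)$, $v\in V$. The intersection graph of a family of sets has a vertex per set and an edge between two distinct sets iff they intersect. -}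

module Defs where

open import Data.Nat using (ℕ; zero; suc; _+_; _∸_; _≤_; _<_)
open import Data.Fin using (Fin; toℕ)
open import Data.Fin.Properties using (_≟_)
open import Data.Fin.Subset using (Subset; _∈_; _∉_; _⊆_)
open import Data.List using (List; length; filter; map; allFin)
open import Data.Nat.ListAction using (sum)
open import Data.Rational as ℚ using (ℚ)
open import Data.Product using (Σ; ∃; _×_)
open import Relation.Binary.PropositionalEquality using (_≡_; _≢_)
open import Relation.Nullary using (¬_)
open import Function.Bundles using (_⇔_)
import Data.Nat.Properties as ℕP

record Graph (n : ℕ) : Set₁ where
  field
    Adj     : Fin n → Fin n → Set
    sym     : ∀ {u v} → Adj u v → Adj v u
    irrefl  : ∀ {v} → ¬ Adj v v
open Graph public

InRInterval : ℚ → ℚ → ℚ → Set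
InRInterval a b x = a ℚ.≤ x × x ℚ.≤ b

IsIntervalGraph : ∀ {n} → Graph n → Set
IsIntervalGraph {n} G =
  Σ (Fin n → ℚ) λ a → Σ (Fin n → ℚ) λ b →
    (∀ v → a v ℚ.≤ b v) ×
    (∀ u v → u ≢ v →
       (Adj G u v ⇔ ∃ λ x → InRInterval (a u) (b u) x × InRInterval (a v) (b v) x))

IsClique : ∀ {n} → Graph n → Subset n → Set
IsClique G S = ∀ u v → u ∈ S → v ∈ S → u ≢ v → Adj G u v

IsMaximalClique : ∀ {n} → Graph n → Subset n → Set
IsMaximalClique G S = IsClique G S × (∀ T → IsClique G T → S ⊆ T → T ⊆ S)

record ConsecutiveCliqueOrdering {n} (G : Graph n) (r : ℕ) (Q : Fin r → Subset n) : Set where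
  field
    maximal     : ∀ i → IsMaximalClique G (Q i)
    complete    : ∀ S → IsMaximalClique G S → ∃ λ i → Q i ≡ S
    distinct    : ∀ i j → Q i ≡ Q j → i ≡ j
    consecutive : ∀ v i j k → toℕ i ≤ toℕ j → toℕ j ≤ toℕ k →
                  v ∈ Q i → v ∈ Q k → v ∈ Q j

record FirstLast {n r} (Q : Fin r → Subset n) (lf rt : Fin n → Fin r) : Set where
  field
    lf-mem   : ∀ v → v ∈ Q (lf v)
    lf-first : ∀ v i → v ∈ Q i → toℕ (lf v) ≤ toℕ i
    rt-mem   : ∀ v → v ∈ Q (rt v)
    rt-last  : ∀ v i → v ∈ Q i → toℕ i ≤ toℕ (rt v)

countEq : ∀ {n r} → (Fin n → Fin r) → Fin r → ℕ
countEq {n} f i = length (filter (λ v → f v ≟ i) (allFin n))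

tSize sSize : ∀ {n r} → (lf rt : Fin n → Fin r) → Fin r → ℕ
tSize lf rt i = countEq lf i
sSize lf rt i = countEq rt i

-- posL v = k  iff v is the k-th vertex (1-based) in the list of L_{l(v)},
-- posR v = k  iff v is the k-th vertex (1-based) in the list of R_{r(v)}.
-- Ties are broken arbitrarily: any such positions are allowed.
record Positions {n r} (lf rt : Fin n → Fin r) (posL posR : Fin n → ℕ) : Set where
  field
    posL-range : ∀ v → 1 ≤ posL v × posL v ≤ tSize lf rt (lf v)
    posL-inj   : ∀ u v → lf u ≡ lf v → posL u ≡ posL v → u ≡ v
    posL-order : ∀ u v → lf u ≡ lf v → posL u < posL v → toℕ (rt v) ≤ toℕ (rt u)
    posR-range : ∀ v → 1 ≤ posR v × posR v ≤ sSize lf rt (rt v)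
    posR-inj   : ∀ u v → rt u ≡ rt v → posR u ≡ posR v → u ≡ v
    posR-order : ∀ u v → rt u ≡ rt v → posR u < posR v → toℕ (lf u) ≤ toℕ (lf v)

gadgetSize : ∀ {n r} → (lf rt : Fin n → Fin r) → Fin r → ℕ
gadgetSize lf rt i = (tSize lf rt i ∸ 1) + 1 + (sSize lf rt i ∸ 1)

-- first point of gadget D_i: the gadgets D_1,…,D_r are placed left to
-- right starting at point 0, with exactly one extra point between
-- consecutive gadgets.
gadgetStart : ∀ {n r} → (lf rt : Fin n → Fin r) → Fin r → ℕ
gadgetStart {r = r} lf rt i =
  sum (map (λ j → gadgetSize lf rt j + 1)
           (filter (λ j → toℕ j ℕP.<? toℕ i) (allFin r)))

zPt : ∀ {n r} → (lf rt : Fin n → Fin r) → Fin r → ℕ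
zPt lf rt i = gadgetStart lf rt i + (tSize lf rt i ∸ 1)

leftEnd : ∀ {n r} → (lf rt : Fin n → Fin r) → (posL : Fin n → ℕ) → Fin n → ℕ
leftEnd lf rt posL v = zPt lf rt (lf v) ∸ (posL v ∸ 1)

rightEnd : ∀ {n r} → (lf rt : Fin n → Fin r) → (posR : Fin n → ℕ) → Fin n → ℕ
rightEnd lf rt posR v = zPt lf rt (rt v) + (posR v ∸ 1)

InJ : ∀ {n r} → (lf rt : Fin n → Fin r) → (posL posR : Fin n → ℕ) →
      Fin n → ℕ → Set
InJ lf rt posL posR v x = leftEnd lf rt posL v ≤ x × x ≤ rightEnd lf rt posR v

{-# OPTIONS --safe #-}
-- Two vertices are adjacent iff they lie in a common maximal clique Q_i, since every
-- edge extends to a maximal clique (greedily, adjacency being decidable for an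
-- interval graph). If v ∈ Q_i then J(v) contains z_i, because the z_i increase with i.
-- Conversely, the gadgets are disjoint and ordered, so if J(u) and J(v) meet with
-- l(u) ≤ l(v) then l(v) ≤ r(u), and by consecutiveness both u and v lie in Q_{l(v)}.
-- Finally J(v) determines v: its left end lies in gadget D_{l(v)}, at offset
-- posL(v) - 1 to the left of z_{l(v)}.
module Submission where

open import Defs
open import Data.Nat using (ℕ; _+_; _∸_; _≤_; _<_)
open import Data.Nat.Properties hiding (_≟_)
open import Data.Nat.ListAction using (sum)
open import Data.Nat.Tactic.RingSolver using (solve-∀)
open import Data.Fin using (Fin; toℕ)
open import Data.Fin.Properties using (_≟_; all?; toℕ-injective)
open import Data.Fin.Subset using (Subset; _∈_; _⊆_; ⁅_⁆; _∪_)
open import Data.Fin.Subset.Properties using (_∈?_; x∈⁅x⁆; x∈⁅y⁆⇒x≡y; x∈p∪q⁻; p⊆p∪q; q⊆p∪q)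
open import Data.List using (List; []; _∷_; allFin; filter; map)
open import Data.List.Relation.Unary.Any using (here; there)
import Data.List.Membership.Propositional as List
open import Data.List.Membership.Propositional.Properties using (∈-allFin)
open import Data.Product using (∃; _×_; _,_; proj₁; proj₂)
open import Data.Sum using (inj₁; inj₂)
import Data.Rational as ℚ
import Data.Rational.Properties as ℚₚ
open import Relation.Binary.PropositionalEquality as ≡ using (_≡_; _≢_; refl; cong; subst)
open import Relation.Binary.Definitions using (tri<; tri≈; tri>)
open import Relation.Nullary using (¬_; Dec; yes; no; contradiction)
open import Relation.Nullary.Decidable using (_→-dec_; ¬?; map′)
open import Relation.Unary using (Pred; Decidable)
open import Function.Bundles using (_⇔_; mk⇔; Equivalence)

closedIntervals-meet? : ∀ {a b c d} → a ℚ.≤ b → c ℚ.≤ d →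
                        Dec (∃ λ x → InRInterval a b x × InRInterval c d x)
closedIntervals-meet? {a} {b} {c} {d} a≤b c≤d with a ℚ.≤? d | c ℚ.≤? b
... | no a≰d | _ = no λ (x , (a≤x , _) , (_ , x≤d)) → a≰d (ℚₚ.≤-trans a≤x x≤d)
... | _ | no c≰b = no λ (x , (_ , x≤b) , (c≤x , _)) → c≰b (ℚₚ.≤-trans c≤x x≤b)
... | yes a≤d | yes c≤b with ℚₚ.≤-total a c
...   | inj₁ a≤c = yes (c , (a≤c , c≤b) , (ℚₚ.≤-refl , c≤d))
...   | inj₂ c≤a = yes (a , (ℚₚ.≤-refl , a≤b) , (c≤a , a≤d))

intervalGraph-adj? : ∀ {n} (G : Graph n) → IsIntervalGraph G → ∀ u v → Dec (Adj G u v)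
intervalGraph-adj? G (a , b , a≤b , adj⇔meet) u v with u ≟ v
... | yes refl = no (irrefl G)
... | no u≢v = map′ (Equivalence.from (adj⇔meet u v u≢v)) (Equivalence.to (adj⇔meet u v u≢v))
                    (closedIntervals-meet? (a≤b u) (a≤b v))

module CliqueExtension {n} (G : Graph n) (adj? : ∀ u v → Dec (Adj G u v)) where

  Compatible : Subset n → Fin n → Set
  Compatible C w = ∀ y → y ∈ C → y ≢ w → Adj G y w

  compatible? : ∀ C w → Dec (Compatible C w)
  compatible? C w = all? λ y → y ∈? C →-dec (¬? (y ≟ w) →-dec adj? y w)

  singleton-clique : ∀ v → IsClique G ⁅ v ⁆
  singleton-clique v x y x∈ y∈ x≢y =
    contradiction (≡.trans (x∈⁅y⁆⇒x≡y v x∈) (≡.sym (x∈⁅y⁆⇒x≡y v y∈))) x≢y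

  insert-clique : ∀ {C w} → IsClique G C → Compatible C w → IsClique G (⁅ w ⁆ ∪ C)
  insert-clique {C} {w} clq compat x y x∈ y∈ x≢y with x∈p∪q⁻ ⁅ w ⁆ C x∈ | x∈p∪q⁻ ⁅ w ⁆ C y∈
  ... | inj₁ x∈w | inj₁ y∈w = singleton-clique w x y x∈w y∈w x≢y
  ... | inj₁ x∈w | inj₂ y∈C with x∈⁅y⁆⇒x≡y w x∈w
  ...   | refl = Graph.sym G (compat y y∈C λ y≡x → x≢y (≡.sym y≡x))
  insert-clique clq compat x y x∈ y∈ x≢y | inj₂ x∈C | inj₁ y∈w with x∈⁅y⁆⇒x≡y _ y∈w
  ...   | refl = compat x x∈C x≢y
  insert-clique clq compat x y x∈ y∈ x≢y | inj₂ x∈C | inj₂ y∈C = clq x y x∈C y∈C x≢y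

  edge-clique : ∀ {u v} → Adj G u v → IsClique G (⁅ u ⁆ ∪ ⁅ v ⁆)
  edge-clique {u} {v} uv = insert-clique (singleton-clique v) λ y y∈v _ →
    subst (λ y → Adj G y u) (≡.sym (x∈⁅y⁆⇒x≡y v y∈v)) (Graph.sym G uv)

  grow : Subset n → List (Fin n) → Subset n
  grow S [] = S
  grow S (w ∷ ws) with compatible? (grow S ws) w
  ... | yes _ = ⁅ w ⁆ ∪ grow S ws
  ... | no _ = grow S ws

  grow-∷-⊇ : ∀ S w ws → grow S ws ⊆ grow S (w ∷ ws)
  grow-∷-⊇ S w ws with compatible? (grow S ws) w
  ... | yes _ = q⊆p∪q ⁅ w ⁆ (grow S ws)
  ... | no _ = λ x∈ → x∈

  ⊆-grow : ∀ S ws → S ⊆ grow S ws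
  ⊆-grow S [] x∈ = x∈
  ⊆-grow S (w ∷ ws) x∈ = grow-∷-⊇ S w ws (⊆-grow S ws x∈)

  grow-clique : ∀ {S} → IsClique G S → ∀ ws → IsClique G (grow S ws)
  grow-clique clq [] = clq
  grow-clique {S} clq (w ∷ ws) with compatible? (grow S ws) w
  ... | yes compat = insert-clique (grow-clique clq ws) compat
  ... | no _ = grow-clique clq ws

  grow-saturated : ∀ {S T} → IsClique G T → ∀ ws → grow S ws ⊆ T →
                   ∀ {w} → w ∈ T → w List.∈ ws → w ∈ grow S ws
  grow-saturated {S} clqT (w ∷ ws) sub w∈T (here refl) with compatible? (grow S ws) w
  ... | yes _ = p⊆p∪q (grow S ws) (x∈⁅x⁆ w)
  ... | no incompatible =
    contradiction (λ y y∈ y≢w → clqT y w (sub y∈) w∈T y≢w) incompatible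
  grow-saturated {S} clqT (x ∷ ws) sub w∈T (there w∈ws) =
    grow-∷-⊇ S x ws (grow-saturated clqT ws (λ y∈ → sub (grow-∷-⊇ S x ws y∈)) w∈T w∈ws)

  extendToMaximalClique : ∀ {S} → IsClique G S → ∃ λ M → IsMaximalClique G M × S ⊆ M
  extendToMaximalClique {S} clq =
    grow S (allFin n) ,
    (grow-clique clq (allFin n) ,
     λ T clqT sub w∈T → grow-saturated clqT (allFin n) sub w∈T (∈-allFin _)) ,
    ⊆-grow S (allFin n)

InCommonClique : ∀ {n r} → (Fin r → Subset n) → Fin n → Fin n → Set
InCommonClique Q u v = ∃ λ i → u ∈ Q i × v ∈ Q i

module _ {n r} {G : Graph n} {Q : Fin r → Subset n} (co : ConsecutiveCliqueOrdering G r Q) where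
  open ConsecutiveCliqueOrdering co

  inCommonClique⇒adjacent : ∀ {u v} → u ≢ v → InCommonClique Q u v → Adj G u v
  inCommonClique⇒adjacent u≢v (i , u∈ , v∈) = proj₁ (maximal i) _ _ u∈ v∈ u≢v

  adjacent⇒inCommonClique : (∀ u v → Dec (Adj G u v)) →
                            ∀ {u v} → Adj G u v → InCommonClique Q u v
  adjacent⇒inCommonClique adj? {u} {v} uv = common (extendToMaximalClique (edge-clique uv))
    where
    open CliqueExtension G adj?
    common : (∃ λ M → IsMaximalClique G M × (⁅ u ⁆ ∪ ⁅ v ⁆) ⊆ M) → InCommonClique Q u v
    common (M , M-maximal , uv⊆M) with complete M M-maximal
    ... | i , refl = i , uv⊆M (p⊆p∪q ⁅ v ⁆ (x∈⁅x⁆ u)) , uv⊆M (q⊆p∪q ⁅ u ⁆ ⁅ v ⁆ (x∈⁅x⁆ v))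

module _ {a p q} {A : Set a} (f : A → ℕ) {P : Pred A p} {P′ : Pred A q}
         (P? : Decidable P) (P′? : Decidable P′) (P⊆P′ : ∀ {x} → P x → P′ x) where

  sum-filter-mono : ∀ xs → sum (map f (filter P? xs)) ≤ sum (map f (filter P′? xs))
  sum-filter-mono [] = ≤-refl
  sum-filter-mono (x ∷ xs) with P? x | P′? x
  ... | yes _  | yes _    = +-monoʳ-≤ (f x) (sum-filter-mono xs)
  ... | yes Px | no ¬P′x  = contradiction (P⊆P′ Px) ¬P′x
  ... | no _   | yes _    = ≤-trans (sum-filter-mono xs) (m≤n+m _ (f x))
  ... | no _   | no _     = sum-filter-mono xs

  sum-filter-extra : ∀ {y} → ¬ P y → P′ y → ∀ {xs} → y List.∈ xs →
                     sum (map f (filter P? xs)) + f y ≤ sum (map f (filter P′? xs))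
  sum-filter-extra {y} ¬Py P′y {y ∷ xs} (here refl) with P? y | P′? y
  ... | yes Py | _       = contradiction Py ¬Py
  ... | no _   | no ¬P′y = contradiction P′y ¬P′y
  ... | no _   | yes _   =
    ≤-trans (≤-reflexive (+-comm _ (f y))) (+-monoʳ-≤ (f y) (sum-filter-mono xs))
  sum-filter-extra ¬Py P′y {x ∷ xs} (there y∈xs) with P? x | P′? x
  ... | yes Px | no ¬P′x = contradiction (P⊆P′ Px) ¬P′x
  ... | yes _  | yes _   =
    ≤-trans (≤-reflexive (+-assoc (f x) _ _)) (+-monoʳ-≤ (f x) (sum-filter-extra ¬Py P′y y∈xs))
  ... | no _   | yes _   = ≤-trans (sum-filter-extra ¬Py P′y y∈xs) (m≤n+m _ (f x))
  ... | no _   | no _    = sum-filter-extra ¬Py P′y y∈xs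

module GadgetLayout {n r} (lf rt : Fin n → Fin r) where

  gadgetEnd : Fin r → ℕ
  gadgetEnd i = zPt lf rt i + (sSize lf rt i ∸ 1)

  gadgetEnd<gadgetStart : ∀ {i k} → toℕ i < toℕ k → gadgetEnd i < gadgetStart lf rt k
  gadgetEnd<gadgetStart {i} {k} i<k = begin-strict
    gadgetEnd i                                   <⟨ m<m+n (gadgetEnd i) {2} 0<1+n ⟩
    gadgetEnd i + 2                               ≡⟨ layout (gadgetStart lf rt i) _ _ ⟩
    gadgetStart lf rt i + (gadgetSize lf rt i + 1) ≤⟨ sum-filter-extra _ _ _ (λ j<i → <-trans j<i i<k)
                                                        (<-irrefl refl) i<k (∈-allFin i) ⟩
    gadgetStart lf rt k                           ∎
    where
    open ≤-Reasoning
    layout : ∀ g a b → g + a + b + 2 ≡ g + (a + 1 + b + 1)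
    layout = solve-∀

  zPt-mono : ∀ {i k} → toℕ i ≤ toℕ k → zPt lf rt i ≤ zPt lf rt k
  zPt-mono {i} {k} i≤k with m≤n⇒m<n∨m≡n i≤k
  ... | inj₂ i≡k rewrite toℕ-injective i≡k = ≤-refl
  ... | inj₁ i<k =
    ≤-trans (m≤m+n _ _) (≤-trans (<⇒≤ (gadgetEnd<gadgetStart i<k)) (m≤m+n _ _))

module StretchedIntervals {n r} {Q : Fin r → Subset n} {lf rt : Fin n → Fin r}
                          (fl : FirstLast Q lf rt)
                          {posL posR : Fin n → ℕ} (ps : Positions lf rt posL posR) where
  open FirstLast fl
  open Positions ps
  open GadgetLayout lf rt

  J : Fin n → ℕ → Set
  J = InJ lf rt posL posR

  ℓ ρ : Fin n → ℕ
  ℓ = leftEnd lf rt posL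
  ρ = rightEnd lf rt posR

  z : Fin r → ℕ
  z = zPt lf rt

  offset≤zPt : ∀ v → posL v ∸ 1 ≤ z (lf v)
  offset≤zPt v = ≤-trans (∸-monoˡ-≤ 1 (proj₂ (posL-range v))) (m≤n+m _ _)

  gadgetStart≤leftEnd : ∀ v → gadgetStart lf rt (lf v) ≤ ℓ v
  gadgetStart≤leftEnd v = ≤-trans (m≤m+n _ _) (≤-reflexive (≡.sym (+-∸-assoc _ offset≤t)))
    where
    offset≤t : posL v ∸ 1 ≤ tSize lf rt (lf v) ∸ 1
    offset≤t = ∸-monoˡ-≤ 1 (proj₂ (posL-range v))

  leftEnd≤zPt : ∀ v → ℓ v ≤ z (lf v)
  leftEnd≤zPt v = m∸n≤m (z (lf v)) (posL v ∸ 1)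

  zPt≤rightEnd : ∀ v → z (rt v) ≤ ρ v
  zPt≤rightEnd v = m≤m+n _ _

  rightEnd≤gadgetEnd : ∀ v → ρ v ≤ gadgetEnd (rt v)
  rightEnd≤gadgetEnd v = +-monoʳ-≤ (z (rt v)) (∸-monoˡ-≤ 1 (proj₂ (posR-range v)))

  zPt∈J : ∀ v i → toℕ (lf v) ≤ toℕ i → toℕ i ≤ toℕ (rt v) → J v (z i)
  zPt∈J v i lf≤i i≤rt = ≤-trans (leftEnd≤zPt v) (zPt-mono lf≤i) ,
                        ≤-trans (zPt-mono i≤rt) (zPt≤rightEnd v)

  leftEnd∈J : ∀ v → J v (ℓ v)
  leftEnd∈J v = ≤-refl , ≤-trans (leftEnd≤zPt v) (proj₂ (zPt∈J v (lf v) ≤-refl (lf-first v (rt v) (rt-mem v))))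

  rt<lf⇒rightEnd<leftEnd : ∀ {u v} → toℕ (rt u) < toℕ (lf v) → ρ u < ℓ v
  rt<lf⇒rightEnd<leftEnd lt =
    <-≤-trans (≤-<-trans (rightEnd≤gadgetEnd _) (gadgetEnd<gadgetStart lt)) (gadgetStart≤leftEnd _)

  lf<lf⇒leftEnd< : ∀ {u v} → toℕ (lf u) < toℕ (lf v) → ℓ u < ℓ v
  lf<lf⇒leftEnd< lt =
    <-≤-trans (≤-<-trans (≤-trans (leftEnd≤zPt _) (m≤m+n _ _)) (gadgetEnd<gadgetStart lt))
              (gadgetStart≤leftEnd _)

  J-meet⇒lf≤rt : ∀ {u v x} → J u x → J v x → toℕ (lf v) ≤ toℕ (rt u)
  J-meet⇒lf≤rt (_ , x≤ρu) (ℓv≤x , _) with toℕ (lf _) ≤? toℕ (rt _)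
  ... | yes lf≤rt = lf≤rt
  ... | no lf≰rt = contradiction (≤-trans ℓv≤x x≤ρu) (<⇒≱ (rt<lf⇒rightEnd<leftEnd (≰⇒> lf≰rt)))

  inCommonClique⇒J-meet : ∀ {u v} → InCommonClique Q u v → ∃ λ x → J u x × J v x
  inCommonClique⇒J-meet {u} {v} (i , u∈ , v∈) =
    z i , zPt∈J u i (lf-first u i u∈) (rt-last u i u∈) , zPt∈J v i (lf-first v i v∈) (rt-last v i v∈)

  module _ {G : Graph n} (co : ConsecutiveCliqueOrdering G r Q) where
    open ConsecutiveCliqueOrdering co

    J-meet⇒inCommonClique : ∀ {u v x} → J u x → J v x → InCommonClique Q u v
    J-meet⇒inCommonClique {u} {v} Ju Jv with ≤-total (toℕ (lf u)) (toℕ (lf v))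
    ... | inj₁ lfu≤lfv =
      lf v , consecutive u (lf u) (lf v) (rt u) lfu≤lfv (J-meet⇒lf≤rt Ju Jv) (lf-mem u) (rt-mem u) ,
             lf-mem v
    ... | inj₂ lfv≤lfu =
      lf u , lf-mem u ,
             consecutive v (lf v) (lf u) (rt v) lfv≤lfu (J-meet⇒lf≤rt Jv Ju) (lf-mem v) (rt-mem v)

  leftEnd⇒lf≡ : ∀ {u v} → ℓ u ≡ ℓ v → lf u ≡ lf v
  leftEnd⇒lf≡ {u} {v} ℓu≡ℓv with <-cmp (toℕ (lf u)) (toℕ (lf v))
  ... | tri< lt _ _ = contradiction ℓu≡ℓv (<⇒≢ (lf<lf⇒leftEnd< lt))
  ... | tri≈ _ eq _ = toℕ-injective eq
  ... | tri> _ _ gt = contradiction (≡.sym ℓu≡ℓv) (<⇒≢ (lf<lf⇒leftEnd< gt))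

  leftEnd-injective : ∀ {u v} → ℓ u ≡ ℓ v → u ≡ v
  leftEnd-injective {u} {v} ℓu≡ℓv =
    posL-inj u v lf≡ (∸-cancelʳ-≡ (proj₁ (posL-range u)) (proj₁ (posL-range v)) offsets≡)
    where
    lf≡ : lf u ≡ lf v
    lf≡ = leftEnd⇒lf≡ ℓu≡ℓv
    offsets≡ : posL u ∸ 1 ≡ posL v ∸ 1
    offsets≡ = ∸-cancelˡ-≡ (offset≤zPt u)
                 (subst (λ i → posL v ∸ 1 ≤ z i) (≡.sym lf≡) (offset≤zPt v))
                 (≡.trans ℓu≡ℓv (cong (λ i → z i ∸ (posL v ∸ 1)) (≡.sym lf≡)))

  J-injective : ∀ u v → (∀ x → J u x ⇔ J v x) → u ≡ v
  J-injective u v Ju⇔Jv = leftEnd-injective (≤-antisym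
    (proj₁ (Equivalence.from (Ju⇔Jv (ℓ v)) (leftEnd∈J v)))
    (proj₁ (Equivalence.to (Ju⇔Jv (ℓ u)) (leftEnd∈J u))))

lemma1 : ∀ {n r} (G : Graph n) → IsIntervalGraph G →
         (Q : Fin r → Subset n) → ConsecutiveCliqueOrdering G r Q →
         (lf rt : Fin n → Fin r) → FirstLast Q lf rt →
         (posL posR : Fin n → ℕ) → Positions lf rt posL posR →
         -- v ↦ J(v) is injective (distinct vertices give distinct hyperedges)
         (∀ u v → (∀ x → InJ lf rt posL posR u x ⇔ InJ lf rt posL posR v x) → u ≡ v) ×
         -- and is an isomorphism onto the intersection graph of the J(v)
         (∀ u v → u ≢ v →
            (Adj G u v ⇔ ∃ λ x → InJ lf rt posL posR u x × InJ lf rt posL posR v x))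
lemma1 G interval Q co lf rt fl posL posR ps =
  J-injective , λ u v u≢v → mk⇔
    (λ uv → inCommonClique⇒J-meet (adjacent⇒inCommonClique co (intervalGraph-adj? G interval) uv))
    (λ (x , Ju , Jv) → inCommonClique⇒adjacent co u≢v (J-meet⇒inCommonClique co Ju Jv))
  where open StretchedIntervals fl ps
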